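{- Let $j\ge2$ and let $\mu$ be a composition having a part equal to $j$ and a part equal to $j-1$. Let $m$ be the number of parts of $\mu$ equal to $j$ that lie to the left of the leftmost part of $\mu$ equal to $j-1$. Then for all $0\le k\le m$, $$\mathfrak{t}_j\mathfrak{t}_{j+1}^{k}(\mu)=\mathfrak{t}_{j+1}^{k}\mathfrak{t}_j(\mu).$$
   Context: A composition is a finite sequence $\mu=(\mu_1,\ldots,\mu_r)$ of positive integers. Box-adding operators: $\mathfrak{t}_1(\mu)=(1,\mu_1,\ldots,\mu_r)$; for $i\ge2$, $\mathfrak{t}_i(\mu)$ is obtained by increasing by one the leftmost part of $\mu$ equal to $i-1$ if one exists, and $\mathfrak{t}_i(\mu)=0$ otherwise; $\mathfrak{t}_i(0)=0$. Products of operators are compositions of maps (rightmost applied first). -}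

module Defs where

open import Data.Nat using (ℕ; zero; suc; _<_; _≟_)
open import Data.List using (List; []; _∷_)
open import Data.List.Relation.Unary.All using (All)
open import Data.List.Membership.Propositional using (_∈_)
open import Data.Maybe using (Maybe; just; nothing; _>>=_)
open import Data.Maybe using () renaming (map to mapMaybe)
open import Relation.Nullary using (yes; no)

IsComposition : List ℕ → Set
IsComposition μ = All (0 <_) μ

-- Elements of the span: a composition, or the zero vector (nothing).
-- (Positivity is preserved by all operators, so we work on List ℕ.)

bumpLeftmost : ℕ → List ℕ → Maybe (List ℕ)
bumpLeftmost a [] = nothing
bumpLeftmost a (x ∷ xs) with x ≟ a
... | yes _ = just (suc x ∷ xs)
... | no  _ = mapMaybe (x ∷_) (bumpLeftmost a xs)

-- Box-adding operator t_i on a single composition (i ≥ 1; t_0 is unused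
-- and set to 0 by convention).
tc : ℕ → List ℕ → Maybe (List ℕ)
tc zero          μ = nothing
tc (suc zero)    μ = just (1 ∷ μ)
tc (suc (suc i)) μ = bumpLeftmost (suc i) μ

t : ℕ → Maybe (List ℕ) → Maybe (List ℕ)
t i x = x >>= tc i

t^ : ℕ → ℕ → Maybe (List ℕ) → Maybe (List ℕ)
t^ i zero    x = x
t^ i (suc k) x = t i (t^ i k x)

countBefore : ℕ → ℕ → List ℕ → ℕ
countBefore j b [] = 0
countBefore j b (x ∷ xs) with x ≟ b
... | yes _ = 0
... | no  _ with x ≟ j
...   | yes _ = suc (countBefore j b xs)
...   | no  _ = countBefore j b xs

-- Write j = b + 2, so that t_j bumps the leftmost part b + 1 and t_{j+1} the
-- leftmost part j. Scanning μ from the left, a part that is neither b + 1 nor j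
-- is invisible to both operators. A part equal to j met before any b + 1 is
-- bumped to j + 1 by the first application of t_{j+1} and is invisible to t_j
-- both before and after, so it uses up one of the k applications of t_{j+1}
-- without affecting t_j. Hence the two sides agree as long as k does not
-- exceed the number of such parts.
module Submission where

open import Defs
open import Data.Nat using (ℕ; suc; zero; _≤_; _∸_; _≟_; s≤s; s≤s⁻¹)
open import Data.Nat.Properties using (1+n≢n; m≢1+n+m; ≟-diag)
open import Data.List using (List; []; _∷_)
open import Data.List.Membership.Propositional using (_∈_)
open import Data.Maybe using (Maybe; just; nothing)
open import Data.Maybe using () renaming (map to mapMaybe)
open import Relation.Nullary using (Dec; yes; no; contradiction)
open import Relation.Binary.PropositionalEquality

t^-suc : ∀ i k m → t^ i (suc k) m ≡ t^ i k (t i m)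
t^-suc i zero    m = refl
t^-suc i (suc k) m = cong (t i) (t^-suc i k m)

t-cons-skip : ∀ {c x} → x ≢ suc c → ∀ m →
  t (suc (suc c)) (mapMaybe (x ∷_) m) ≡ mapMaybe (x ∷_) (t (suc (suc c)) m)
t-cons-skip x≢ nothing   = refl
t-cons-skip x≢ (just ys) rewrite ≢-≟-identity _≟_ x≢ = refl

t^-cons-skip : ∀ {c x} → x ≢ suc c → ∀ k m →
  t^ (suc (suc c)) k (mapMaybe (x ∷_) m) ≡ mapMaybe (x ∷_) (t^ (suc (suc c)) k m)
t^-cons-skip x≢ zero    m = refl
t^-cons-skip x≢ (suc k) m =
  trans (cong (t _) (t^-cons-skip x≢ k m)) (t-cons-skip x≢ (t^ _ k m))

t-cons-bump : ∀ c m → t (suc (suc c)) (mapMaybe (suc c ∷_) m) ≡ mapMaybe (suc (suc c) ∷_) m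
t-cons-bump c nothing   = refl
t-cons-bump c (just ys) rewrite ≟-diag (refl {x = suc c}) = refl

t^-suc-cons-bump : ∀ c k m →
  t^ (suc (suc c)) (suc k) (mapMaybe (suc c ∷_) m) ≡ mapMaybe (suc (suc c) ∷_) (t^ (suc (suc c)) k m)
t^-suc-cons-bump c k m = begin
  t^ i (suc k) (mapMaybe (suc c ∷_) m)   ≡⟨ t^-suc i k _ ⟩
  t^ i k (t i (mapMaybe (suc c ∷_) m))   ≡⟨ cong (t^ i k) (t-cons-bump c m) ⟩
  t^ i k (mapMaybe (suc (suc c) ∷_) m)   ≡⟨ t^-cons-skip 1+n≢n k m ⟩
  mapMaybe (suc (suc c) ∷_) (t^ i k m)   ∎
  where
  open ≡-Reasoning
  i = suc (suc c)

countBefore-stop : ∀ j {b x xs} → x ≡ b → countBefore j b (x ∷ xs) ≡ 0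
countBefore-stop j x≡b rewrite ≡-≟-identity _≟_ x≡b = refl

countBefore-count : ∀ {j b x xs} → x ≢ b → x ≡ j → countBefore j b (x ∷ xs) ≡ suc (countBefore j b xs)
countBefore-count x≢b x≡j rewrite ≢-≟-identity _≟_ x≢b | ≡-≟-identity _≟_ x≡j = refl

countBefore-skip : ∀ {j b x xs} → x ≢ b → x ≢ j → countBefore j b (x ∷ xs) ≡ countBefore j b xs
countBefore-skip x≢b x≢j rewrite ≢-≟-identity _≟_ x≢b | ≢-≟-identity _≟_ x≢j = refl

Commutes : ℕ → ℕ → Maybe (List ℕ) → Set
Commutes j k m = t j (t^ (suc j) k m) ≡ t^ (suc j) k (t j m)

module _ {b : ℕ} where
  private
    j = suc (suc b)

  commutes-cons-skip : ∀ {x k m} → x ≢ suc b → x ≢ j →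
    Commutes j k m → Commutes j k (mapMaybe (x ∷_) m)
  commutes-cons-skip {x} {k} {m} x≢b+1 x≢j comm = begin
    t j (t^ (suc j) k (mapMaybe (x ∷_) m))   ≡⟨ cong (t j) (t^-cons-skip x≢j k m) ⟩
    t j (mapMaybe (x ∷_) (t^ (suc j) k m))   ≡⟨ t-cons-skip x≢b+1 (t^ (suc j) k m) ⟩
    mapMaybe (x ∷_) (t j (t^ (suc j) k m))   ≡⟨ cong (mapMaybe (x ∷_)) comm ⟩
    mapMaybe (x ∷_) (t^ (suc j) k (t j m))   ≡⟨ t^-cons-skip x≢j k (t j m) ⟨
    t^ (suc j) k (mapMaybe (x ∷_) (t j m))   ≡⟨ cong (t^ (suc j) k) (t-cons-skip x≢b+1 m) ⟨
    t^ (suc j) k (t j (mapMaybe (x ∷_) m))   ∎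
    where open ≡-Reasoning

  commutes-cons-bump : ∀ {k m} → Commutes j k m → Commutes j (suc k) (mapMaybe (j ∷_) m)
  commutes-cons-bump {k} {m} comm = begin
    t j (t^ (suc j) (suc k) (mapMaybe (j ∷_) m))   ≡⟨ cong (t j) (t^-suc-cons-bump (suc b) k m) ⟩
    t j (mapMaybe (suc j ∷_) (t^ (suc j) k m))     ≡⟨ t-cons-skip j+1≢b+1 (t^ (suc j) k m) ⟩
    mapMaybe (suc j ∷_) (t j (t^ (suc j) k m))     ≡⟨ cong (mapMaybe (suc j ∷_)) comm ⟩
    mapMaybe (suc j ∷_) (t^ (suc j) k (t j m))     ≡⟨ t^-suc-cons-bump (suc b) k (t j m) ⟨
    t^ (suc j) (suc k) (mapMaybe (j ∷_) (t j m))   ≡⟨ cong (t^ (suc j) (suc k)) (t-cons-skip 1+n≢n m) ⟨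
    t^ (suc j) (suc k) (t j (mapMaybe (j ∷_) m))   ∎
    where
    open ≡-Reasoning
    j+1≢b+1 : suc j ≢ suc b
    j+1≢b+1 = ≢-sym (m≢1+n+m (suc b) {1})

  commutes-below-countBefore : ∀ μ k → k ≤ countBefore j (suc b) μ → Commutes j k (just μ)
  commutes-below-countBefore μ        zero    _  = refl
  commutes-below-countBefore []       (suc k) ()
  commutes-below-countBefore (x ∷ xs) (suc k) k≤ = by-cases (x ≟ suc b) (x ≟ j)
    where
    -- Splitting with `with` would also rewrite the goal and break its match with the lemmas.
    by-cases : Dec (x ≡ suc b) → Dec (x ≡ j) → Commutes j (suc k) (just (x ∷ xs))
    by-cases (yes x≡b+1) _ = contradiction (subst (suc k ≤_) (countBefore-stop j x≡b+1) k≤) λ ()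
    by-cases (no x≢b+1) (yes x≡j) =
      subst (λ y → Commutes j (suc k) (just (y ∷ xs))) (sym x≡j)
        (commutes-cons-bump {k} {just xs}
          (commutes-below-countBefore xs k
            (s≤s⁻¹ (subst (suc k ≤_) (countBefore-count x≢b+1 x≡j) k≤))))
    by-cases (no x≢b+1) (no x≢j) =
      commutes-cons-skip {x} {suc k} {just xs} x≢b+1 x≢j
        (commutes-below-countBefore xs (suc k) (subst (suc k ≤_) (countBefore-skip x≢b+1 x≢j) k≤))

lemma5p13 : (j : ℕ) → 2 ≤ j → (μ : List ℕ) → IsComposition μ →
    j ∈ μ → (j ∸ 1) ∈ μ →
    (k : ℕ) → k ≤ countBefore j (j ∸ 1) μ →
    t j (t^ (suc j) k (just μ)) ≡ t^ (suc j) k (t j (just μ))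
lemma5p13 (suc zero) (s≤s ())
lemma5p13 (suc (suc b)) _ μ _ _ _ k k≤m = commutes-below-countBefore μ k k≤m
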